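{- Let $\kappa\le\lambda$ be cardinals. If $U$ is a normal, fine ultrafilter on $P_\kappa(\lambda)$, then $U$ is a $P_{\lambda^+}$-point.
   Context: $P_\kappa(\lambda)=\{x\subseteq\lambda:|x|<\kappa\}$. An ultrafilter on $P_\kappa(\lambda)$ is fine if it contains every cone $\{x:\alpha\in x\}$, $\alpha<\lambda$, and normal if it is closed under diagonal intersections $\triangle_{\alpha<\lambda}X_\alpha=\{x:\forall\alpha\in x\,(x\in X_\alpha)\}$. $\mathrm{Fine}(\kappa,\lambda)$ is the filter generated by the cones, and $\mathrm{Fine}(\kappa,\lambda)^*$ is its dual ideal. A fine ultrafilter $U$ on $P_\kappa(\lambda)$ is a $P_\mu$-point if for every $\rho<\mu$ and every $\langle X_i:i<\rho\rangle\subseteq U$ there is $A\in U$ with $A\setminus X_i\in\mathrm{Fine}(\kappa,\lambda)^*$ for all $i<\rho$. -}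

module Defs where

open import Level using (Lift; lift)
open import Data.Empty using (⊥)
open import Data.Product using (Σ; _×_; _,_; proj₁)
open import Data.Sum using (_⊎_)
open import Data.List using (List)
open import Data.List.Relation.Unary.All using (All)
open import Relation.Nullary using (¬_)
open import Function.Definitions using (Injective)
open import Relation.Binary.PropositionalEquality using (_≡_)

-- Cardinals are represented by (carrier) types; |A| ≤ |B| means there is an
-- injection A → B.
_≼_ : Set → Set → Set
A ≼ B = Σ (A → B) (λ f → Injective _≡_ _≡_ f)

Subset : Set → Set₁
Subset Λ = Λ → Set

-- |x| ≥ κ : some injection K → Λ whose values all lie in x.
KEmbedsIn : (K Λ : Set) → Subset Λ → Set
KEmbedsIn K Λ x = Σ (K → Λ) (λ f → Injective _≡_ _≡_ f × (∀ k → x (f k)))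

-- P_κ(λ) = { x ⊆ λ : |x| < κ }  (|x| < κ ⟺ ¬ κ ≤ |x|)
P : (K Λ : Set) → Set₁
P K Λ = Σ (Subset Λ) (λ x → ¬ KEmbedsIn K Λ x)

Fam : (K Λ : Set) → Set₂
Fam K Λ = P K Λ → Set₁

module _ {K Λ : Set} where

  _∩_ : Fam K Λ → Fam K Λ → Fam K Λ
  (A ∩ B) x = A x × B x

  _∖_ : Fam K Λ → Fam K Λ → Fam K Λ
  (A ∖ B) x = A x × ¬ B x

  compl : Fam K Λ → Fam K Λ
  compl A x = ¬ A x

  ∅ : Fam K Λ
  ∅ _ = Lift _ ⊥

  cone : Λ → Fam K Λ
  cone α x = Lift _ (proj₁ x α)

  △ : (Λ → Fam K Λ) → Fam K Λ
  △ X x = ∀ α → proj₁ x α → X α x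

  -- B ∈ Fine(κ,λ)^* : the complement of B contains a finite intersection
  -- of cones, i.e. there is a finite F ⊆ λ with B ∩ ⋂_{α∈F} cone α = ∅.
  FineIdeal : Fam K Λ → Set₁
  FineIdeal B = Σ (List Λ) (λ F → ∀ x → All (λ α → proj₁ x α) F → ¬ B x)

  record IsUltrafilter (U : Fam K Λ → Set₁) : Set₂ where
    field
      upward  : ∀ {A B} → U A → (∀ x → A x → B x) → U B
      meet    : ∀ {A B} → U A → U B → U (A ∩ B)
      proper  : ¬ U ∅
      ultra   : ∀ A → U A ⊎ U (compl A)

  IsFine : (Fam K Λ → Set₁) → Set₁
  IsFine U = ∀ α → U (cone α)

  IsNormal : (Fam K Λ → Set₁) → Set₂
  IsNormal U = (X : Λ → Fam K Λ) → (∀ α → U (X α)) → U (△ X)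

  -- U is a P_{λ⁺}-point: for every ρ < λ⁺ (i.e. every index set I with
  -- |I| ≤ λ) and every family ⟨X_i : i ∈ I⟩ ⊆ U there is A ∈ U with
  -- A ∖ X_i ∈ Fine(κ,λ)^* for all i.
  IsPλ⁺Point : (Fam K Λ → Set₁) → Set₂
  IsPλ⁺Point U = (I : Set) → I ≼ Λ → (X : I → Fam K Λ) → (∀ i → U (X i)) →
    Σ (Fam K Λ) (λ A → U A × (∀ i → FineIdeal (A ∖ X i)))

{-# OPTIONS --safe #-}
-- Transfer the family along an injection e : I → λ and set
-- Y α = ⋂ { X i : e i = α }. By injectivity each Y α is either a single X i or
-- all of P_κ(λ), so Y α ∈ U, and by normality A = △ Y ∈ U. A point of A lying
-- in the cone of e i lies in Y (e i) ⊆ X i, so A ∖ X i misses that cone.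
module Submission where

open import Defs
open import Level using (lift)
open import Data.Empty using (⊥-elim)
open import Data.Product using (Σ; _,_)
open import Data.Sum using (inj₁; inj₂)
open import Data.List using ([]; _∷_)
open import Data.List.Relation.Unary.All using ([]; _∷_)
open import Relation.Nullary using (¬_)
open import Function.Definitions using (Injective)
open import Relation.Binary.PropositionalEquality using (_≡_; refl; sym; subst)

module UltrafilterProperties {K Λ : Set} {U : Fam K Λ → Set₁}
                             (isUltrafilter : IsUltrafilter U) where

  open IsUltrafilter isUltrafilter

  ∈⇒compl∉ : ∀ {A} → U A → ¬ U (compl A)
  ∈⇒compl∉ a c = proper (upward (meet a c) λ { x (ax , cx) → lift (cx ax) })

  compl∉⇒∈ : ∀ {A} → ¬ U (compl A) → U A
  compl∉⇒∈ {A} c∉ with ultra A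
  ... | inj₁ a = a
  ... | inj₂ c = ⊥-elim (c∉ c)

module _ {K Λ I : Set} where

  fibreMeet : (I → Λ) → (I → Fam K Λ) → Λ → Fam K Λ
  fibreMeet e X α x = ∀ i → e i ≡ α → X i x

  X⊆fibreMeet : {e : I → Λ} → Injective _≡_ _≡_ e → (X : I → Fam K Λ) →
                ∀ i x → X i x → fibreMeet e X (e i) x
  X⊆fibreMeet e-inj X i x xi j ej≡ei = subst (λ k → X k x) (e-inj (sym ej≡ei)) xi

  -- Whether α lies in the image of e is undecidable here; instead, if the
  -- complement were in U, the fibre over α would be empty, making the meet
  -- everything.
  fibreMeet∈U : {U : Fam K Λ → Set₁} → IsUltrafilter U →
                {e : I → Λ} → Injective _≡_ _≡_ e →
                {X : I → Fam K Λ} → (∀ i → U (X i)) →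
                ∀ α → U (fibreMeet e X α)
  fibreMeet∈U {U} isUltrafilter {e} e-inj {X} X∈U α = compl∉⇒∈ λ c →
      ∈⇒compl∉ (upward c λ x _ i ei≡α → ⊥-elim (fibre-empty c (i , ei≡α))) c
    where
    open IsUltrafilter isUltrafilter
    open UltrafilterProperties isUltrafilter

    fibre-empty : U (compl (fibreMeet e X α)) → ¬ Σ I (λ i → e i ≡ α)
    fibre-empty c (i , refl) = ∈⇒compl∉ (upward (X∈U i) (X⊆fibreMeet e-inj X i)) c

  △fibreMeet∖X∈FineIdeal : (e : I → Λ) (X : I → Fam K Λ) →
                           ∀ i → FineIdeal (△ (fibreMeet e X) ∖ X i)
  △fibreMeet∖X∈FineIdeal e X i =
    (e i ∷ []) , λ { x (ei∈x ∷ []) (x∈△ , x∉Xi) → x∉Xi (x∈△ (e i) ei∈x i refl) }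

proposition4p6 : (K Λ : Set) → K ≼ Λ → (U : Fam K Λ → Set₁) →
    IsUltrafilter U → IsFine U → IsNormal U → IsPλ⁺Point U
proposition4p6 K Λ _ U isUltrafilter _ normal I (e , e-inj) X X∈U =
    △ (fibreMeet e X)
  , normal (fibreMeet e X) (fibreMeet∈U isUltrafilter e-inj X∈U)
  , △fibreMeet∖X∈FineIdeal e X
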